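{- Let $m\ge1$, let $p_1=3,p_2,\dots,p_m$ be the first $m$ odd primes, $M=p_1p_2\cdots p_m$ and $M_i=M/p_i$. For integers $x$ and $n\ge1$ let $[x]_n$ denote the least nonnegative residue of $x$ modulo $n$, and let $\{y\}=y-\lfloor y\rfloor$ denote the fractional part. Fix an integer $h$ with $m/2^h<1/4$. For an integer $x$ put $\xi_i=[x\,M_i^{ -1}]_{p_i}$ (where $M_i^{ -1}$ is the inverse of $M_i$ modulo $p_i$), $s_i=\lfloor 2^h\xi_i/p_i\rfloor$, and $\sigma(x)=\sum_{i=1}^m s_i2^{ -h}$. Define $k^*(x)=\min\{k\ge 0: \{\sigma([2^kx]_M)\}\le 3/4\}$. Then for every integer $x$: (i) $k^*(x)<\infty$; (ii) $k^*(x)\le 2^{\mathrm{poly}(m)}$, i.e. $k^*(x)$ is bounded by $2^{P(m)}$ for a polynomial $P$ independent of $x$; (iii) if $k^*(x)>0$, then $[x]_M/M<1/2$ if and only if $[[2^{k^*(x)}x]_M]_2=0$. -}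

module Defs where

open import Data.Nat using (ℕ; zero; suc; _+_; _*_; _^_; _≤_; _<_)
import Data.Nat as ℕ
open import Data.Integer using (ℤ; +_)
import Data.Integer as ℤ
open import Data.Fin using (Fin; toℕ)
import Data.Fin as Fin
open import Data.List using (List; []; _∷_)
open import Data.Product using (Σ; ∃; _×_)
open import Data.Nat.Primality using (Prime)
open import Relation.Binary.PropositionalEquality using (_≡_; _≢_)
open import Relation.Nullary using (¬_; Dec; yes; no)

-- Total versions of natural division / remainder (divisor 0 never occurs
-- under the hypotheses of the lemma; the value chosen there is irrelevant).
_%'_ : ℕ → ℕ → ℕ
n %' zero  = 0
n %' suc d = n ℕ.% suc d

_/'_ : ℕ → ℕ → ℕ
n /' zero  = 0
n /' suc d = n ℕ./ suc d

[_]ℤ_ : ℤ → ℕ → ℕ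
[ x ]ℤ zero  = 0
[ x ]ℤ suc d = x ℤ.%ℕ suc d

sumF : (m : ℕ) → (Fin m → ℕ) → ℕ
sumF zero    f = 0
sumF (suc m) f = f Fin.zero + sumF m (λ i → f (Fin.suc i))

prodF : (m : ℕ) → (Fin m → ℕ) → ℕ
prodF zero    f = 1
prodF (suc m) f = f Fin.zero * prodF m (λ i → f (Fin.suc i))

IsFirstOddPrimes : (m : ℕ) → (Fin m → ℕ) → Set
IsFirstOddPrimes m p =
  (∀ i → Prime (p i) × p i ≢ 2)
  × (∀ i j → toℕ i < toℕ j → p i < p j)
  × (∀ q → Prime q → q ≢ 2 → ∀ i → q < p i → ∃ λ j → p j ≡ q)

bigM : (m : ℕ) → (Fin m → ℕ) → ℕ
bigM m p = prodF m p

bigMi : (m : ℕ) → (Fin m → ℕ) → Fin m → ℕ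
bigMi m p i = bigM m p /' p i

IsInverses : (m : ℕ) → (Fin m → ℕ) → (Fin m → ℕ) → Set
IsInverses m p inv = ∀ i → (inv i * bigMi m p i) %' p i ≡ 1 %' p i

xi : (m : ℕ) → (Fin m → ℕ) → (Fin m → ℕ) → ℕ → Fin m → ℕ
xi m p inv y i = (y * inv i) %' p i

si : (m : ℕ) → (Fin m → ℕ) → (Fin m → ℕ) → ℕ → ℕ → Fin m → ℕ
si m p inv h y i = (2 ^ h * xi m p inv y i) /' p i

-- σ(y) = (Σ sᵢ) / 2^h ; we record its numerator Σ sᵢ
sigmaNum : (m : ℕ) → (Fin m → ℕ) → (Fin m → ℕ) → ℕ → ℕ → ℕ
sigmaNum m p inv h y = sumF m (si m p inv h y)

-- {σ(y)} ≤ 3/4, i.e. 4 · ((Σ sᵢ) mod 2^h) ≤ 3 · 2^h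
FracSigmaSmall : (m : ℕ) → (Fin m → ℕ) → (Fin m → ℕ) → ℕ → ℕ → Set
FracSigmaSmall m p inv h y = 4 * (sigmaNum m p inv h y %' (2 ^ h)) ≤ 3 * 2 ^ h

Good : (m : ℕ) → (Fin m → ℕ) → (Fin m → ℕ) → ℕ → ℤ → ℕ → Set
Good m p inv h x k = FracSigmaSmall m p inv h ([ (+ (2 ^ k)) ℤ.* x ]ℤ bigM m p)

IsKStar : (m : ℕ) → (Fin m → ℕ) → (Fin m → ℕ) → ℕ → ℤ → ℕ → Set
IsKStar m p inv h x k = Good m p inv h x k × (∀ j → j < k → ¬ Good m p inv h x j)

-- polynomials with natural coefficients (constant term first)
evalPoly : List ℕ → ℕ → ℕ
evalPoly []       n = 0
evalPoly (c ∷ cs) n = c + n * evalPoly cs n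

{-# OPTIONS --safe #-}
-- Let y = [x]_M.  By the Chinese remainder theorem Σ ξᵢ Mᵢ = y + c M for some c, and since
-- sᵢ / 2^h underestimates ξᵢ / pᵢ by less than 2^-h, the number c + y / M lies in
-- [σ(y), σ(y) + m / 2^h] where m / 2^h < 1/4.  Hence {σ(y)} > 3/4 forces y / M ∉ [1/4, 3/4].
-- Doubling modulo M doubles a point below M/4 and doubles the distance to M of a point
-- above 3M/4, and neither can land in the other quarter; so as long as k*(x) is not reached,
-- 2^k y < M/4 or 2^k (M − y) < M/4.  Euclid's bound p_{i+1} ≤ 2 p₁⋯pᵢ + 1 gives M ≤ 2^K for
-- K = 2^(m+1), whence k*(x) ≤ K.  Finally, the point preceding k*(x) lies in the lower
-- quarter (then y < M/2 and [2^k* x]_M = 2u is even) or in the upper one (then y > M/2 and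
-- [2^k* x]_M = 2u − M is odd, as M is odd).
module Submission where

open import Defs
open import Data.Nat using (ℕ; _+_; _*_; _^_; _≤_; _<_)
open import Data.Integer using (ℤ; +_) renaming (_*_ to _*ℤ_)
open import Data.Fin using (Fin)
open import Data.List using (List)
open import Data.Product using (Σ; ∃; _×_)
open import Function.Bundles using (_⇔_)
open import Relation.Binary.PropositionalEquality using (_≡_)

open import Algebra.Properties.CommutativeSemigroup using (interchange)
open import Data.Empty using (⊥-elim)
open import Data.Fin using (zero; suc; toℕ; inject₁; fromℕ; fromℕ<)
open import Data.Fin.Relation.Unary.Top using (view; ‵fromℕ; ‵inject₁)
import Data.Fin.Properties as Fin
import Data.Integer as ℤ
open import Data.Integer using (-[1+_])
open import Data.Integer.DivMod using (a≡a%ℕn+[a/ℕn]*n; n%ℕd<d)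
import Data.Integer.Properties as ℤ
import Data.Integer.Tactic.RingSolver as ℤ-Ring
open import Data.List using ([]; _∷_)
open import Data.Nat.ListAction using (product)
open import Data.List.Relation.Unary.All using (_∷_)
open import Data.Nat using (zero; suc; _∸_; NonZero; >-nonZero; >-nonZero⁻¹; z<s; _%_; _/_; z≤n; s≤s; _≤?_)
open import Data.Nat.DivMod
open import Data.Nat.Divisibility
open import Data.Nat.Primality
open import Data.Nat.Primality.Factorisation using (factorise)
open import Data.Nat.Properties
import Data.Nat.Tactic.RingSolver as ℕ-Ring
open import Data.Product using (_,_; proj₁; proj₂)
open import Data.Sum using (_⊎_; inj₁; inj₂)
open import Function using (_∘_)
open import Function.Bundles using (mk⇔)
open import Function.Definitions using (Injective)
open import Relation.Binary.Definitions using (tri<; tri≈; tri>)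
open import Relation.Binary.PropositionalEquality
  using (_≢_; refl; sym; trans; cong; cong₂; subst; subst₂; module ≡-Reasoning)
open import Relation.Nullary using (¬_; Dec; yes; no)

sumF-mono-≤ : ∀ m {f g : Fin m → ℕ} → (∀ i → f i ≤ g i) → sumF m f ≤ sumF m g
sumF-mono-≤ zero    f≤g = z≤n
sumF-mono-≤ (suc m) f≤g = +-mono-≤ (f≤g zero) (sumF-mono-≤ m (f≤g ∘ suc))

sumF-+ : ∀ m (f g : Fin m → ℕ) → sumF m (λ i → f i + g i) ≡ sumF m f + sumF m g
sumF-+ zero    f g = refl
sumF-+ (suc m) f g =
  trans (cong (λ t → f zero + g zero + t) (sumF-+ m (f ∘ suc) (g ∘ suc)))
        (interchange +-commutativeSemigroup (f zero) (g zero) _ _)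

sumF-*ʳ : ∀ m (f : Fin m → ℕ) c → sumF m f * c ≡ sumF m (λ i → f i * c)
sumF-*ʳ zero    f c = refl
sumF-*ʳ (suc m) f c =
  trans (*-distribʳ-+ c (f zero) _) (cong (λ t → f zero * c + t) (sumF-*ʳ m (f ∘ suc) c))

sumF-const : ∀ m c → sumF m (λ _ → c) ≡ m * c
sumF-const zero    c = refl
sumF-const (suc m) c = cong (λ t → c + t) (sumF-const m c)

sumF-zero : ∀ m {f : Fin m → ℕ} → (∀ i → f i ≡ 0) → sumF m f ≡ 0
sumF-zero zero    f≡0 = refl
sumF-zero (suc m) f≡0 = cong₂ _+_ (f≡0 zero) (sumF-zero m (f≡0 ∘ suc))

∣sumF : ∀ m {f : Fin m → ℕ} {d} → (∀ i → d ∣ f i) → d ∣ sumF m f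
∣sumF zero    d∣f = _ ∣0
∣sumF (suc m) d∣f = ∣m∣n⇒∣m+n (d∣f zero) (∣sumF m (d∣f ∘ suc))

sumF-%-single : ∀ m (f : Fin m → ℕ) d .{{_ : NonZero d}} j →
                (∀ i → i ≢ j → d ∣ f i) → sumF m f % d ≡ f j % d
sumF-%-single (suc m) f d zero    d∣f =
  %-remove-+ʳ (f zero) (∣sumF m (λ i → d∣f (suc i) (λ ())))
sumF-%-single (suc m) f d (suc j) d∣f =
  trans (%-remove-+ˡ (sumF m (f ∘ suc)) (d∣f zero (λ ())))
        (sumF-%-single m (f ∘ suc) d j (λ i i≢j → d∣f (suc i) (i≢j ∘ Fin.suc-injective)))

∣prodF : ∀ m (f : Fin m → ℕ) i → f i ∣ prodF m f
∣prodF (suc m) f zero    = m∣m*n _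
∣prodF (suc m) f (suc i) = ∣n⇒∣m*n (f zero) (∣prodF m (f ∘ suc) i)

prodF-nonZero : ∀ m (f : Fin m → ℕ) → (∀ i → NonZero (f i)) → NonZero (prodF m f)
prodF-nonZero zero    f f≢0 = _
prodF-nonZero (suc m) f f≢0 =
  m*n≢0 (f zero) _ {{f≢0 zero}} {{prodF-nonZero m (f ∘ suc) (f≢0 ∘ suc)}}

prodF-odd : ∀ m (f : Fin m → ℕ) → (∀ i → f i % 2 ≡ 1) → prodF m f % 2 ≡ 1
prodF-odd zero    f odd = refl
prodF-odd (suc m) f odd =
  trans (%-distribˡ-* (f zero) _ 2)
        (cong₂ (λ a b → a * b % 2) (odd zero) (prodF-odd m (f ∘ suc) (odd ∘ suc)))

prodF-inject₁ : ∀ m (f : Fin (suc m) → ℕ) → prodF (suc m) f ≡ prodF m (f ∘ inject₁) * f (fromℕ m)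
prodF-inject₁ zero    f = *-comm (f zero) 1
prodF-inject₁ (suc m) f =
  trans (cong (f zero *_) (prodF-inject₁ m (f ∘ suc))) (sym (*-assoc (f zero) _ _))

prime∣prime⇒≡ : ∀ {p q} → Prime p → Prime q → p ∣ q → p ≡ q
prime∣prime⇒≡ pp pq p∣q with prime⇒irreducible pq p∣q
... | inj₁ refl = ⊥-elim (¬prime[1] pp)
... | inj₂ p≡q  = p≡q

-- Write n = k * f 0; every other f i divides k, since it cannot divide the prime f 0.
prodF-∣ : ∀ m (f : Fin m → ℕ) → (∀ i → Prime (f i)) → Injective _≡_ _≡_ f →
          ∀ {n} → (∀ i → f i ∣ n) → prodF m f ∣ n
prodF-∣ zero    f f-prime f-injective {n} f∣n = 1∣ n
prodF-∣ (suc m) f f-prime f-injective {n} f∣n with f∣n zero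
... | divides k refl = subst (prodF (suc m) f ∣_) (*-comm (f zero) k)
        (*-monoʳ-∣ (f zero) (prodF-∣ m (f ∘ suc) (f-prime ∘ suc) (Fin.suc-injective ∘ f-injective) f∣k))
  where
  f∣k : ∀ i → f (suc i) ∣ k
  f∣k i with euclidsLemma k (f zero) (f-prime (suc i)) (f∣n (suc i))
  ... | inj₁ fi∣k  = fi∣k
  ... | inj₂ fi∣f0 with f-injective (prime∣prime⇒≡ (f-prime (suc i)) (f-prime zero) fi∣f0)
  ...   | ()

%'≡% : ∀ a n .{{_ : NonZero n}} → a %' n ≡ a % n
%'≡% a (suc n) = refl

/'≡/ : ∀ a n .{{_ : NonZero n}} → a /' n ≡ a / n
/'≡/ a (suc n) = refl

[]ℤ≡%ℕ : ∀ x n .{{_ : NonZero n}} → [ x ]ℤ n ≡ x ℤ.%ℕ n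
[]ℤ≡%ℕ x (suc n) = refl

[m%d*n]%d≡[m*n]%d : ∀ m n d .{{_ : NonZero d}} → m % d * n % d ≡ m * n % d
[m%d*n]%d≡[m*n]%d m n d = begin
  m % d * n % d             ≡⟨ %-distribˡ-* (m % d) n d ⟩
  m % d % d * (n % d) % d   ≡⟨ cong (λ t → t * (n % d) % d) (m%n%n≡m%n m d) ⟩
  m % d * (n % d) % d       ≡⟨ %-distribˡ-* m n d ⟨
  m * n % d                 ∎
  where open ≡-Reasoning

[m*n%d]%d≡[m*n]%d : ∀ m n d .{{_ : NonZero d}} → m * (n % d) % d ≡ m * n % d
[m*n%d]%d≡[m*n]%d m n d =
  trans (cong (_% d) (*-comm m (n % d)))
        (trans ([m%d*n]%d≡[m*n]%d n m d) (cong (_% d) (*-comm n m)))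

[n+kd]%ℕd≡n%d : ∀ n k d .{{_ : NonZero d}} → (+ n ℤ.+ k ℤ.* + d) ℤ.%ℕ d ≡ n % d
[n+kd]%ℕd≡n%d n k d = sym (n%d≡r (q ℤ.- k) n≡r+[q-k]d)
  where
  z = + n ℤ.+ k ℤ.* + d
  r = z ℤ.%ℕ d
  q = z ℤ./ℕ d

  n≡r+[q-k]d : + n ≡ + r ℤ.+ (q ℤ.- k) ℤ.* + d
  n≡r+[q-k]d = begin
    + n                                       ≡⟨ cancel (+ n) k (+ d) ⟩
    z ℤ.- k ℤ.* + d                           ≡⟨ cong (ℤ._- k ℤ.* + d) (a≡a%ℕn+[a/ℕn]*n z d) ⟩
    (+ r ℤ.+ q ℤ.* + d) ℤ.- k ℤ.* + d         ≡⟨ regroup (+ r) q k (+ d) ⟩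
    + r ℤ.+ (q ℤ.- k) ℤ.* + d                 ∎
    where
    open ≡-Reasoning
    cancel : ∀ a b c → a ≡ (a ℤ.+ b ℤ.* c) ℤ.- b ℤ.* c
    cancel = ℤ-Ring.solve-∀
    regroup : ∀ a b c e → (a ℤ.+ b ℤ.* e) ℤ.- c ℤ.* e ≡ a ℤ.+ (b ℤ.- c) ℤ.* e
    regroup = ℤ-Ring.solve-∀

  n%d≡r : ∀ j → + n ≡ + r ℤ.+ j ℤ.* + d → n % d ≡ r
  n%d≡r (+ j) eq = begin
    n % d           ≡⟨ cong (_% d) n≡r+jd ⟩
    (r + j * d) % d ≡⟨ [m+kn]%n≡m%n r j d ⟩
    r % d           ≡⟨ m<n⇒m%n≡m (n%ℕd<d z d) ⟩
    r               ∎
    where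
    open ≡-Reasoning
    n≡r+jd : n ≡ r + j * d
    n≡r+jd = ℤ.+-injective (begin
      + n                  ≡⟨ eq ⟩
      + r ℤ.+ + j ℤ.* + d  ≡⟨ cong (ℤ._+_ (+ r)) (ℤ.pos-* j d) ⟨
      + r ℤ.+ + (j * d)    ≡⟨ ℤ.pos-+ r (j * d) ⟨
      + (r + j * d)        ∎)
  n%d≡r -[1+ j ] eq = ⊥-elim (<⇒≱ (n%ℕd<d z d) d≤r)
    where
    open ≡-Reasoning
    undo : ∀ b c e → (b ℤ.+ (ℤ.- c) ℤ.* e) ℤ.+ c ℤ.* e ≡ b
    undo = ℤ-Ring.solve-∀
    n+[1+j]d≡r : n + suc j * d ≡ r
    n+[1+j]d≡r = ℤ.+-injective (begin
      + (n + suc j * d)                               ≡⟨ ℤ.pos-+ n (suc j * d) ⟩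
      + n ℤ.+ + (suc j * d)                           ≡⟨ cong (ℤ._+_ (+ n)) (ℤ.pos-* (suc j) d) ⟩
      + n ℤ.+ + suc j ℤ.* + d                         ≡⟨ cong (ℤ._+ + suc j ℤ.* + d) eq ⟩
      + r ℤ.+ -[1+ j ] ℤ.* + d ℤ.+ + suc j ℤ.* + d    ≡⟨ undo (+ r) (+ suc j) (+ d) ⟩
      + r                                             ∎)
    d≤r : d ≤ r
    d≤r = subst (d ≤_) n+[1+j]d≡r (≤-trans (m≤m+n d (j * d)) (m≤n+m _ n))

[a*x]ℤ≡a*[x]ℤ% : ∀ a x n .{{_ : NonZero n}} → [ + a *ℤ x ]ℤ n ≡ a * [ x ]ℤ n % n
[a*x]ℤ≡a*[x]ℤ% a x n = begin
  [ + a *ℤ x ]ℤ n                             ≡⟨ []ℤ≡%ℕ (+ a *ℤ x) n ⟩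
  (+ a *ℤ x) ℤ.%ℕ n                           ≡⟨ cong (ℤ._%ℕ n) ax≡ ⟩
  (+ (a * r) ℤ.+ (+ a *ℤ q) *ℤ + n) ℤ.%ℕ n    ≡⟨ [n+kd]%ℕd≡n%d (a * r) (+ a *ℤ q) n ⟩
  a * r % n                                   ≡⟨ cong (λ t → a * t % n) ([]ℤ≡%ℕ x n) ⟨
  a * [ x ]ℤ n % n                            ∎
  where
  open ≡-Reasoning
  r = x ℤ.%ℕ n
  q = x ℤ./ℕ n
  distrib : ∀ a r q n → a *ℤ (r ℤ.+ q *ℤ n) ≡ a *ℤ r ℤ.+ (a *ℤ q) *ℤ n
  distrib = ℤ-Ring.solve-∀
  ax≡ : + a *ℤ x ≡ + (a * r) ℤ.+ (+ a *ℤ q) *ℤ + n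
  ax≡ = begin
    + a *ℤ x                            ≡⟨ cong (+ a *ℤ_) (a≡a%ℕn+[a/ℕn]*n x n) ⟩
    + a *ℤ (+ r ℤ.+ q *ℤ + n)           ≡⟨ distrib (+ a) (+ r) q (+ n) ⟩
    + a *ℤ + r ℤ.+ (+ a *ℤ q) *ℤ + n    ≡⟨ cong (ℤ._+ (+ a *ℤ q) *ℤ + n) (ℤ.pos-* a r) ⟨
    + (a * r) ℤ.+ (+ a *ℤ q) *ℤ + n     ∎

∣+∸⇒≡+* : ∀ {t y n} → y < n → n ∣ t + (n ∸ y) → ∃ λ c → t ≡ y + c * n
∣+∸⇒≡+* {t} {y} {n} y<n (divides zero eq) =
  ⊥-elim (<⇒≱ (m<n⇒0<n∸m y<n) (subst (n ∸ y ≤_) eq (m≤n+m (n ∸ y) t)))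
∣+∸⇒≡+* {t} {y} {n} y<n (divides (suc c) eq) = c , +-cancelʳ-≡ n t (y + c * n) (begin
  t + n               ≡⟨ cong (λ s → t + s) (m∸n+n≡m (<⇒≤ y<n)) ⟨
  t + (n ∸ y + y)     ≡⟨ +-assoc t (n ∸ y) y ⟨
  t + (n ∸ y) + y     ≡⟨ cong (_+ y) eq ⟩
  n + c * n + y       ≡⟨ shuffle n (c * n) y ⟩
  y + c * n + n       ∎)
  where
  open ≡-Reasoning
  shuffle : ∀ a b e → a + b + e ≡ e + b + a
  shuffle = ℕ-Ring.solve-∀

/-sandwich : ∀ v n e .{{_ : NonZero n}} →
             v / n * (n * e) ≤ v * e × v * e ≤ v / n * (n * e) + n * e
/-sandwich v n e = lower , upper
  where
  open ≤-Reasoning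
  regroup : ∀ r q n e → (r + q * n) * e ≡ r * e + q * (n * e)
  regroup = ℕ-Ring.solve-∀
  split : v * e ≡ v % n * e + v / n * (n * e)
  split = trans (cong (_* e) (m≡m%n+[m/n]*n v n)) (regroup (v % n) (v / n) n e)
  lower : v / n * (n * e) ≤ v * e
  lower = begin
    v / n * (n * e)                ≤⟨ m≤n+m _ _ ⟩
    v % n * e + v / n * (n * e)    ≡⟨ split ⟨
    v * e                          ∎
  upper : v * e ≤ v / n * (n * e) + n * e
  upper = begin
    v * e                          ≡⟨ split ⟩
    v % n * e + v / n * (n * e)    ≤⟨ +-monoˡ-≤ _ (*-monoˡ-≤ e (<⇒≤ (m%n<n v n))) ⟩
    n * e + v / n * (n * e)        ≡⟨ +-comm (n * e) _ ⟩
    v / n * (n * e) + n * e        ∎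

FarFromHalf : ℕ → ℕ → Set
FarFromHalf N u = 4 * u < N ⊎ 3 * N < 4 * u

FarFromHalf-*-cancelʳ : ∀ {N u} k → FarFromHalf (N * k) (u * k) → FarFromHalf N u
FarFromHalf-*-cancelʳ {N} {u} k (inj₁ 4uk<Nk) =
  inj₁ (*-cancelʳ-< k (4 * u) N (subst (_< N * k) (sym (*-assoc 4 u k)) 4uk<Nk))
FarFromHalf-*-cancelʳ {N} {u} k (inj₂ 3Nk<4uk) =
  inj₂ (*-cancelʳ-< k (3 * N) (4 * u) (subst₂ _<_ (sym (*-assoc 3 N k)) (sym (*-assoc 4 u k)) 3Nk<4uk))

-- Compare the integer parts a and c of (w + a N) / N and (u + c N) / N.
close-to-high-fraction⇒FarFromHalf :
  ∀ {N u w e a c} → u < N → w < N → 3 * N < 4 * w → 4 * e < N →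
  w + a * N ≤ u + c * N → u + c * N ≤ w + e + a * N → FarFromHalf N u
close-to-high-fraction⇒FarFromHalf {N} {u} {w} {e} {a} {c} u<N w<N 3N<4w 4e<N lower upper
  with <-cmp a c
... | tri< a<c _ _ = inj₁ (+-cancelˡ-< (4 * N) (4 * u) N (begin-strict
  4 * N + 4 * u  ≡⟨ +-comm (4 * N) (4 * u) ⟩
  4 * u + 4 * N  ≡⟨ *-distribˡ-+ 4 u N ⟨
  4 * (u + N)    ≤⟨ *-monoʳ-≤ 4 u+N≤w+e ⟩
  4 * (w + e)    ≡⟨ *-distribˡ-+ 4 w e ⟩
  4 * w + 4 * e  <⟨ +-mono-≤-< (*-monoʳ-≤ 4 (<⇒≤ w<N)) 4e<N ⟩
  4 * N + N      ∎))
  where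
  open ≤-Reasoning
  u+N≤w+e : u + N ≤ w + e
  u+N≤w+e = +-cancelʳ-≤ (a * N) (u + N) (w + e) (begin
    u + N + a * N  ≡⟨ +-assoc u N (a * N) ⟩
    u + suc a * N  ≤⟨ +-monoʳ-≤ u (*-monoˡ-≤ N a<c) ⟩
    u + c * N      ≤⟨ upper ⟩
    w + e + a * N  ∎)
... | tri≈ _ refl _ = inj₂ (<-≤-trans 3N<4w (*-monoʳ-≤ 4 (+-cancelʳ-≤ (a * N) w u lower)))
... | tri> _ _ c<a = ⊥-elim (<⇒≱ u+cN<w+aN lower)
  where
  open ≤-Reasoning
  u+cN<w+aN : u + c * N < w + a * N
  u+cN<w+aN = begin-strict
    u + c * N  <⟨ +-monoˡ-< (c * N) u<N ⟩
    N + c * N  ≤⟨ *-monoˡ-≤ N c<a ⟩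
    a * N      ≤⟨ m≤n+m (a * N) w ⟩
    w + a * N  ∎

-- S / H ≤ (y + c M) / M ≤ S / H + m / H, so y / M is within 1/4 of the fractional part of S / H.
fraction>¾⇒FarFromHalf : ∀ {M H S m y c} .{{_ : NonZero H}} → y < M →
  S * M ≤ (y + c * M) * H → (y + c * M) * H ≤ S * M + m * M →
  4 * m < H → 3 * H < 4 * (S % H) → FarFromHalf M y
fraction>¾⇒FarFromHalf {M} {H} {S} {m} {y} {c} y<M lower upper 4m<H 3H<4r =
  FarFromHalf-*-cancelʳ {M} {y} H (close-to-high-fraction⇒FarFromHalf {e = m * M} {a = a} {c = c}
    (*-monoˡ-< H y<M) rM<MH 3MH<4rM 4mM<MH
    (subst₂ _≤_ S*M≡ yc*H≡ lower) (subst₂ _≤_ yc*H≡ S*M+mM≡ upper))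
  where
  open ≤-Reasoning
  instance
    M-nonZero : NonZero M
    M-nonZero = >-nonZero (≤-<-trans z≤n y<M)
  r = S % H
  a = S / H
  split : ∀ r a H M → (r + a * H) * M ≡ r * M + a * (M * H)
  split = ℕ-Ring.solve-∀
  split+ : ∀ r a H M e → (r + a * H) * M + e ≡ r * M + e + a * (M * H)
  split+ = ℕ-Ring.solve-∀
  S*M≡ : S * M ≡ r * M + a * (M * H)
  S*M≡ = trans (cong (_* M) (m≡m%n+[m/n]*n S H)) (split r a H M)
  S*M+mM≡ : S * M + m * M ≡ r * M + m * M + a * (M * H)
  S*M+mM≡ = trans (cong (λ t → t * M + m * M) (m≡m%n+[m/n]*n S H)) (split+ r a H M (m * M))
  yc*H≡ : (y + c * M) * H ≡ y * H + c * (M * H)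
  yc*H≡ = trans (*-distribʳ-+ H y (c * M)) (cong (λ t → y * H + t) (*-assoc c M H))
  rM<MH : r * M < M * H
  rM<MH = begin-strict
    r * M  <⟨ *-monoˡ-< M (m%n<n S H) ⟩
    H * M  ≡⟨ *-comm H M ⟩
    M * H  ∎
  3MH<4rM : 3 * (M * H) < 4 * (r * M)
  3MH<4rM = begin-strict
    3 * (M * H)  ≡⟨ cong (3 *_) (*-comm M H) ⟩
    3 * (H * M)  ≡⟨ *-assoc 3 H M ⟨
    3 * H * M    <⟨ *-monoˡ-< M 3H<4r ⟩
    4 * r * M    ≡⟨ *-assoc 4 r M ⟩
    4 * (r * M)  ∎
  4mM<MH : 4 * (m * M) < M * H
  4mM<MH = begin-strict
    4 * (m * M)  ≡⟨ *-assoc 4 m M ⟨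
    4 * m * M    <⟨ *-monoˡ-< M 4m<H ⟩
    H * M        ≡⟨ *-comm H M ⟩
    M * H        ∎

-- Chinese remaindering and the approximation by σ

FracSigmaSmall-0 : ∀ m p inv h → FracSigmaSmall m p inv h 0
FracSigmaSmall-0 m p inv h =
  subst (λ s → 4 * (s %' (2 ^ h)) ≤ 3 * 2 ^ h) (sym (sumF-zero m (λ i → s₀≡0 (p i))))
        (subst (λ t → 4 * t ≤ 3 * 2 ^ h) (sym (0%'n≡0 (2 ^ h))) z≤n)
  where
  0%'n≡0 : ∀ n → 0 %' n ≡ 0
  0%'n≡0 zero    = refl
  0%'n≡0 (suc n) = refl
  s₀≡0 : ∀ n → (2 ^ h * (0 %' n)) /' n ≡ 0
  s₀≡0 zero    = refl
  s₀≡0 (suc n) = cong (_/ suc n) (*-zeroʳ (2 ^ h))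

module Reconstruction {m : ℕ} {p : Fin m → ℕ} (inv : Fin m → ℕ)
  (p-prime : ∀ i → Prime (p i)) (p-injective : Injective _≡_ _≡_ p)
  (inverses : IsInverses m p inv) where

  M : ℕ
  M = bigM m p

  instance
    p-nonZero : ∀ {i} → NonZero (p i)
    p-nonZero = prime⇒nonZero (p-prime _)

    M-nonZero : NonZero M
    M-nonZero = prodF-nonZero m p (λ i → prime⇒nonZero (p-prime i))

  M≡p*Mi : ∀ i → M ≡ p i * bigMi m p i
  M≡p*Mi i = sym (trans (cong (p i *_) (/'≡/ M (p i))) (m*[n/m]≡n (∣prodF m p i)))

  p∣Mi : ∀ {i j} → j ≢ i → p j ∣ bigMi m p i
  p∣Mi {i} {j} j≢i with euclidsLemma (p i) _ (p-prime j) (subst (p j ∣_) (M≡p*Mi i) (∣prodF m p j))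
  ... | inj₁ pj∣pi = ⊥-elim (j≢i (p-injective (prime∣prime⇒≡ (p-prime j) (p-prime i) pj∣pi)))
  ... | inj₂ pj∣Mi = pj∣Mi

  ξ*Mi≡y : ∀ y i → xi m p inv y i * bigMi m p i % p i ≡ y % p i
  ξ*Mi≡y y i = begin
    (y * inv i) %' p i * Mi % p i  ≡⟨ cong (λ t → t * Mi % p i) (%'≡% (y * inv i) (p i)) ⟩
    y * inv i % p i * Mi % p i     ≡⟨ [m%d*n]%d≡[m*n]%d (y * inv i) Mi (p i) ⟩
    y * inv i * Mi % p i           ≡⟨ cong (_% p i) (*-assoc y (inv i) Mi) ⟩
    y * (inv i * Mi) % p i         ≡⟨ [m*n%d]%d≡[m*n]%d y (inv i * Mi) (p i) ⟨
    y * (inv i * Mi % p i) % p i   ≡⟨ cong (λ t → y * t % p i) inverse ⟩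
    y * (1 % p i) % p i            ≡⟨ [m*n%d]%d≡[m*n]%d y 1 (p i) ⟩
    y * 1 % p i                    ≡⟨ cong (_% p i) (*-identityʳ y) ⟩
    y % p i                        ∎
    where
    open ≡-Reasoning
    Mi = bigMi m p i
    inverse : inv i * Mi % p i ≡ 1 % p i
    inverse = trans (sym (%'≡% _ (p i))) (trans (inverses i) (%'≡% 1 (p i)))

  crt : ℕ → ℕ
  crt y = sumF m (λ i → xi m p inv y i * bigMi m p i)

  crt≡y+c*M : ∀ y → y < M → ∃ λ c → crt y ≡ y + c * M
  crt≡y+c*M y y<M = ∣+∸⇒≡+* y<M (prodF-∣ m p p-prime p-injective p∣crt+[M∸y])
    where
    p∣crt+[M∸y] : ∀ j → p j ∣ crt y + (M ∸ y)
    p∣crt+[M∸y] j = m%n≡0⇒n∣m _ (p j) (begin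
      (crt y + (M ∸ y)) % p j              ≡⟨ %-distribˡ-+ (crt y) (M ∸ y) (p j) ⟩
      (crt y % p j + (M ∸ y) % p j) % p j  ≡⟨ cong (λ t → (t + (M ∸ y) % p j) % p j) crt≡y ⟩
      (y % p j + (M ∸ y) % p j) % p j      ≡⟨ %-distribˡ-+ y (M ∸ y) (p j) ⟨
      (y + (M ∸ y)) % p j                  ≡⟨ cong (_% p j) (m+[n∸m]≡n (<⇒≤ y<M)) ⟩
      M % p j                              ≡⟨ n∣m⇒m%n≡0 M (p j) (∣prodF m p j) ⟩
      0                                    ∎)
      where
      open ≡-Reasoning
      crt≡y : crt y % p j ≡ y % p j
      crt≡y = trans (sumF-%-single m _ (p j) j p∣term) (ξ*Mi≡y y j)
        where
        p∣term : ∀ i → i ≢ j → p j ∣ xi m p inv y i * bigMi m p i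
        p∣term i i≢j = ∣n⇒∣m*n (xi m p inv y i) (p∣Mi (i≢j ∘ sym))

  sᵢ-sandwich : ∀ h y i →
    si m p inv h y i * M ≤ xi m p inv y i * bigMi m p i * 2 ^ h
    × xi m p inv y i * bigMi m p i * 2 ^ h ≤ si m p inv h y i * M + M
  sᵢ-sandwich h y i with /-sandwich (2 ^ h * xi m p inv y i) (p i) (bigMi m p i)
  ... | lower , upper = subst₂ _≤_ (cong₂ _*_ s≡ pMi≡M) vMi≡ lower
                      , subst₂ _≤_ vMi≡ (cong₂ (λ s N → s * N + N) s≡ pMi≡M) upper
    where
    s≡ : (2 ^ h * xi m p inv y i) / p i ≡ si m p inv h y i
    s≡ = sym (/'≡/ _ (p i))
    pMi≡M : p i * bigMi m p i ≡ M
    pMi≡M = sym (M≡p*Mi i)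
    vMi≡ : 2 ^ h * xi m p inv y i * bigMi m p i ≡ xi m p inv y i * bigMi m p i * 2 ^ h
    vMi≡ = rotate (2 ^ h) (xi m p inv y i) (bigMi m p i)
      where
      rotate : ∀ a b c → a * b * c ≡ b * c * a
      rotate = ℕ-Ring.solve-∀

  σ-sandwich : ∀ h y →
    sigmaNum m p inv h y * M ≤ crt y * 2 ^ h
    × crt y * 2 ^ h ≤ sigmaNum m p inv h y * M + m * M
  σ-sandwich h y = lower , upper
    where
    open ≤-Reasoning
    s = si m p inv h y
    ξMi = λ i → xi m p inv y i * bigMi m p i
    lower : sigmaNum m p inv h y * M ≤ crt y * 2 ^ h
    lower = begin
      sumF m s * M                      ≡⟨ sumF-*ʳ m s M ⟩
      sumF m (λ i → s i * M)            ≤⟨ sumF-mono-≤ m (λ i → proj₁ (sᵢ-sandwich h y i)) ⟩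
      sumF m (λ i → ξMi i * 2 ^ h)      ≡⟨ sumF-*ʳ m ξMi (2 ^ h) ⟨
      crt y * 2 ^ h                     ∎
    upper : crt y * 2 ^ h ≤ sigmaNum m p inv h y * M + m * M
    upper = begin
      crt y * 2 ^ h                               ≡⟨ sumF-*ʳ m ξMi (2 ^ h) ⟩
      sumF m (λ i → ξMi i * 2 ^ h)                ≤⟨ sumF-mono-≤ m (λ i → proj₂ (sᵢ-sandwich h y i)) ⟩
      sumF m (λ i → s i * M + M)                  ≡⟨ sumF-+ m (λ i → s i * M) (λ _ → M) ⟩
      sumF m (λ i → s i * M) + sumF m (λ _ → M)   ≡⟨ cong₂ _+_ (sym (sumF-*ʳ m s M)) (sumF-const m M) ⟩
      sumF m s * M + m * M                        ∎

  ¬FracSigmaSmall⇒FarFromHalf : ∀ h y → 4 * m < 2 ^ h → y < M →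
                                ¬ FracSigmaSmall m p inv h y → FarFromHalf M y
  ¬FracSigmaSmall⇒FarFromHalf h y 4m<H y<M ¬small with crt≡y+c*M y y<M | σ-sandwich h y
  ... | c , crt≡ | lower , upper =
    fraction>¾⇒FarFromHalf {S = S} {m} {c = c} {{m^n≢0 2 h}} y<M
      (subst (λ t → S * M ≤ t * 2 ^ h) crt≡ lower)
      (subst (λ t → t * 2 ^ h ≤ S * M + m * M) crt≡ upper) 4m<H
      (subst (λ t → 3 * 2 ^ h < 4 * t) (%'≡% _ (2 ^ h) {{m^n≢0 2 h}}) (≰⇒> ¬small))
    where S = sigmaNum m p inv h y

-- Doubling modulo M

m*n<m⇒n≡0 : ∀ m n → m * n < m → n ≡ 0
m*n<m⇒n≡0 m zero    _      = refl
m*n<m⇒n≡0 m (suc n) mn<m = ⊥-elim (<⇒≱ mn<m (m≤m*n m (suc n)))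

double-low : ∀ {M u} .{{_ : NonZero M}} → 4 * u < M → 2 * u % M ≡ 2 * u
double-low {M} {u} 4u<M = m<n⇒m%n≡m (≤-<-trans (*-monoˡ-≤ u (m≤m+n 2 2)) 4u<M)

double-high : ∀ {M u} .{{_ : NonZero M}} → u < M → 3 * M < 4 * u → 2 * u % M + M ≡ 2 * u
double-high {M} {u} u<M 3M<4u = begin-equality
  2 * u % M + M          ≡⟨ cong (_+ M) (m≤n⇒[n∸m]%m≡n%m M≤2u) ⟨
  (2 * u ∸ M) % M + M    ≡⟨ cong (_+ M) (m<n⇒m%n≡m 2u∸M<M) ⟩
  2 * u ∸ M + M          ≡⟨ m∸n+n≡m M≤2u ⟩
  2 * u                  ∎
  where
  open ≤-Reasoning
  M≤2u : M ≤ 2 * u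
  M≤2u = *-cancelˡ-≤ 2 (<⇒≤ (begin-strict
    2 * M        ≤⟨ *-monoˡ-≤ M (n≤1+n 2) ⟩
    3 * M        <⟨ 3M<4u ⟩
    4 * u        ≡⟨ *-assoc 2 2 u ⟩
    2 * (2 * u)  ∎))
  2u∸M<M : 2 * u ∸ M < M
  2u∸M<M = +-cancelʳ-< M (2 * u ∸ M) M (begin-strict
    2 * u ∸ M + M  ≡⟨ m∸n+n≡m M≤2u ⟩
    2 * u          <⟨ *-monoʳ-< 2 u<M ⟩
    2 * M          ≡⟨ cong (λ t → M + t) (+-identityʳ M) ⟩
    M + M          ∎)

high⇒4*gap<M : ∀ {M u g} → u + g ≡ M → 3 * M < 4 * u → 4 * g < M
high⇒4*gap<M {M} {u} {g} u+g≡M 3M<4u = +-cancelˡ-< (3 * M) (4 * g) M (begin-strict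
  3 * M + 4 * g  <⟨ +-monoˡ-< (4 * g) 3M<4u ⟩
  4 * u + 4 * g  ≡⟨ *-distribˡ-+ 4 u g ⟨
  4 * (u + g)    ≡⟨ cong (4 *_) u+g≡M ⟩
  M + 3 * M      ≡⟨ +-comm M (3 * M) ⟩
  3 * M + M      ∎)
  where open ≤-Reasoning

4*gap<M⇒high : ∀ {M u g} → u + g ≡ M → 4 * g < M → 3 * M < 4 * u
4*gap<M⇒high {M} {u} {g} u+g≡M 4g<M = +-cancelʳ-< (4 * g) (3 * M) (4 * u) (begin-strict
  3 * M + 4 * g  <⟨ +-monoʳ-< (3 * M) 4g<M ⟩
  3 * M + M      ≡⟨ +-comm (3 * M) M ⟩
  4 * M          ≡⟨ cong (4 *_) u+g≡M ⟨
  4 * (u + g)    ≡⟨ *-distribˡ-+ 4 u g ⟩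
  4 * u + 4 * g  ∎)
  where open ≤-Reasoning

low-stays-below-¾ : ∀ {M u} → 4 * u < M → ¬ 3 * M < 4 * (2 * u)
low-stays-below-¾ {M} {u} 4u<M 3M<8u = <-asym 3M<8u (begin-strict
  4 * (2 * u)  ≡⟨ swap 4 2 u ⟩
  2 * (4 * u)  <⟨ *-monoʳ-< 2 4u<M ⟩
  2 * M        ≤⟨ *-monoˡ-≤ M (n≤1+n 2) ⟩
  3 * M        ∎)
  where
  open ≤-Reasoning
  swap : ∀ a b c → a * (b * c) ≡ b * (a * c)
  swap = ℕ-Ring.solve-∀

high-stays-above-¼ : ∀ {M u v} → 3 * M < 4 * u → v + M ≡ 2 * u → ¬ 4 * v < M
high-stays-above-¼ {M} {u} {v} 3M<4u v+M≡2u 4v<M = <-asym 4v<M (begin-strict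
  M      ≤⟨ m≤m+n M (M + 0) ⟩
  2 * M  <⟨ +-cancelʳ-< (4 * M) (2 * M) (4 * v) 2M+4M<4v+4M ⟩
  4 * v  ∎)
  where
  open ≤-Reasoning
  six : ∀ M → 2 * M + 4 * M ≡ 2 * (3 * M)
  six = ℕ-Ring.solve-∀
  swap : ∀ a b c → a * (b * c) ≡ b * (a * c)
  swap = ℕ-Ring.solve-∀
  2M+4M<4v+4M : 2 * M + 4 * M < 4 * v + 4 * M
  2M+4M<4v+4M = begin-strict
    2 * M + 4 * M  ≡⟨ six M ⟩
    2 * (3 * M)    <⟨ *-monoʳ-< 2 3M<4u ⟩
    2 * (4 * u)    ≡⟨ swap 2 4 u ⟩
    4 * (2 * u)    ≡⟨ cong (4 *_) v+M≡2u ⟨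
    4 * (v + M)    ≡⟨ *-distribˡ-+ 4 v M ⟩
    4 * v + 4 * M  ∎

high-gap-doubles : ∀ {M u v g} → v + M ≡ 2 * u → u + g ≡ M → v + 2 * g ≡ M
high-gap-doubles {M} {u} {v} {g} v+M≡2u u+g≡M = +-cancelʳ-≡ M (v + 2 * g) M (begin
  v + 2 * g + M    ≡⟨ regroup v (2 * g) M ⟩
  v + M + 2 * g    ≡⟨ cong (_+ 2 * g) v+M≡2u ⟩
  2 * u + 2 * g    ≡⟨ *-distribˡ-+ 2 u g ⟨
  2 * (u + g)      ≡⟨ cong (2 *_) u+g≡M ⟩
  M + (M + 0)      ≡⟨ cong (λ t → M + t) (+-identityʳ M) ⟩
  M + M            ∎)
  where
  open ≡-Reasoning
  regroup : ∀ a b c → a + b + c ≡ a + c + b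
  regroup = ℕ-Ring.solve-∀

module Doubling (M : ℕ) .{{_ : NonZero M}} (y : ℕ) (y<M : y < M) where

  orbit : ℕ → ℕ
  orbit k = 2 ^ k * y % M

  orbit-0 : orbit 0 ≡ y
  orbit-0 = trans (cong (_% M) (*-identityˡ y)) (m<n⇒m%n≡m y<M)

  orbit<M : ∀ k → orbit k < M
  orbit<M k = m%n<n (2 ^ k * y) M

  orbit-suc : ∀ k → orbit (suc k) ≡ 2 * orbit k % M
  orbit-suc k = trans (cong (_% M) (*-assoc 2 (2 ^ k) y)) (sym ([m*n%d]%d≡[m*n]%d 2 (2 ^ k * y) M))

  orbit-suc-low : ∀ k → 4 * orbit k < M → orbit (suc k) ≡ 2 * orbit k
  orbit-suc-low k 4u<M = trans (orbit-suc k) (double-low {u = orbit k} 4u<M)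

  orbit-suc-high : ∀ k → 3 * M < 4 * orbit k → orbit (suc k) + M ≡ 2 * orbit k
  orbit-suc-high k 3M<4u =
    trans (cong (_+ M) (orbit-suc k)) (double-high {u = orbit k} (orbit<M k) 3M<4u)

  -- While the orbit avoids [M/4, 3M/4], doubling never wraps around in the
  -- lower quarter and always wraps around exactly once in the upper one.
  Low High : ℕ → Set
  Low  n = 4 * orbit n < M × orbit n ≡ 2 ^ n * y
  High n = 3 * M < 4 * orbit n × orbit n + 2 ^ n * (M ∸ y) ≡ M

  FarRun : ℕ → Set
  FarRun n = ∀ j → j ≤ n → FarFromHalf M (orbit j)

  far-run⇒Low⊎High : ∀ n → FarRun n → Low n ⊎ High n
  far-run⇒Low⊎High zero    far with far 0 z≤n
  ... | inj₁ 4y<M = inj₁ (4y<M , trans orbit-0 (sym (*-identityˡ y)))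
  ... | inj₂ 3M<4y =
    inj₂ (3M<4y , trans (cong₂ _+_ orbit-0 (*-identityˡ (M ∸ y))) (m+[n∸m]≡n (<⇒≤ y<M)))
  far-run⇒Low⊎High (suc n) far =
    step (far-run⇒Low⊎High n (λ j j≤n → far j (m≤n⇒m≤1+n j≤n))) (far (suc n) ≤-refl)
    where
    D = M ∸ y
    step : Low n ⊎ High n → FarFromHalf M (orbit (suc n)) → Low (suc n) ⊎ High (suc n)
    step (inj₁ (4u<M , u≡)) (inj₁ 4v<M) = inj₁ (4v<M , (begin
      orbit (suc n)    ≡⟨ orbit-suc-low n 4u<M ⟩
      2 * orbit n      ≡⟨ cong (2 *_) u≡ ⟩
      2 * (2 ^ n * y)  ≡⟨ *-assoc 2 (2 ^ n) y ⟨
      2 ^ suc n * y    ∎))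
      where open ≡-Reasoning
    step (inj₁ (4u<M , _)) (inj₂ 3M<4v) =
      ⊥-elim (low-stays-below-¾ {u = orbit n} 4u<M
                (subst (λ v → 3 * M < 4 * v) (orbit-suc-low n 4u<M) 3M<4v))
    step (inj₂ (3M<4u , _)) (inj₁ 4v<M) =
      ⊥-elim (high-stays-above-¼ {u = orbit n} 3M<4u (orbit-suc-high n 3M<4u) 4v<M)
    step (inj₂ (3M<4u , u+G≡M)) (inj₂ 3M<4v) = inj₂ (3M<4v ,
      trans (cong (λ t → orbit (suc n) + t) (*-assoc 2 (2 ^ n) D))
            (high-gap-doubles {u = orbit n} {g = 2 ^ n * D} (orbit-suc-high n 3M<4u) u+G≡M))

  far-run⇒y≡0 : ∀ n → M ≤ 2 ^ n → FarRun n → y ≡ 0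
  far-run⇒y≡0 n M≤2ⁿ far with far-run⇒Low⊎High n far
  ... | inj₁ (4u<M , u≡) = m*n<m⇒n≡0 (2 ^ n) y (begin-strict
    2 ^ n * y        ≤⟨ m≤n*m _ 4 ⟩
    4 * (2 ^ n * y)  ≡⟨ cong (4 *_) u≡ ⟨
    4 * orbit n      <⟨ 4u<M ⟩
    M                ≤⟨ M≤2ⁿ ⟩
    2 ^ n            ∎)
    where open ≤-Reasoning
  ... | inj₂ (3M<4u , u+G≡M) = ⊥-elim (<⇒≢ (m<n⇒0<n∸m y<M) (sym M∸y≡0))
    where
    open ≤-Reasoning
    M∸y≡0 : M ∸ y ≡ 0
    M∸y≡0 = m*n<m⇒n≡0 (2 ^ n) (M ∸ y) (begin-strict
      2 ^ n * (M ∸ y)        ≤⟨ m≤n*m _ 4 ⟩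
      4 * (2 ^ n * (M ∸ y))  <⟨ high⇒4*gap<M {u = orbit n} {g = 2 ^ n * (M ∸ y)} u+G≡M 3M<4u ⟩
      M                      ≤⟨ M≤2ⁿ ⟩
      2 ^ n                  ∎)

  far-run⇒parity : M % 2 ≡ 1 → ∀ n → FarRun n → (2 * y < M ⇔ orbit (suc n) % 2 ≡ 0)
  far-run⇒parity M-odd n far with far-run⇒Low⊎High n far
  ... | inj₁ (4u<M , u≡) = mk⇔ (λ _ → even) (λ _ → 2y<M)
    where
    open ≤-Reasoning
    even : orbit (suc n) % 2 ≡ 0
    even = trans (cong (_% 2) (orbit-suc-low n 4u<M)) (n∣m⇒m%n≡0 _ 2 (m∣m*n (orbit n)))
    2y<M : 2 * y < M
    2y<M = begin-strict
      2 * y            ≤⟨ *-monoˡ-≤ y (m≤m+n 2 2) ⟩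
      4 * y            ≤⟨ *-monoʳ-≤ 4 (m≤n*m y (2 ^ n) {{m^n≢0 2 n}}) ⟩
      4 * (2 ^ n * y)  ≡⟨ cong (4 *_) u≡ ⟨
      4 * orbit n      <⟨ 4u<M ⟩
      M                ∎
  ... | inj₂ (3M<4u , u+G≡M) = mk⇔ (⊥-elim ∘ ¬2y<M) (⊥-elim ∘ odd)
    where
    open ≤-Reasoning
    3M<4y : 3 * M < 4 * y
    3M<4y = 4*gap<M⇒high {u = y} {g = M ∸ y} (m+[n∸m]≡n (<⇒≤ y<M)) (begin-strict
      4 * (M ∸ y)            ≤⟨ *-monoʳ-≤ 4 (m≤n*m (M ∸ y) (2 ^ n) {{m^n≢0 2 n}}) ⟩
      4 * (2 ^ n * (M ∸ y))  <⟨ high⇒4*gap<M {u = orbit n} {g = 2 ^ n * (M ∸ y)} u+G≡M 3M<4u ⟩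
      M                      ∎)
    ¬2y<M : ¬ 2 * y < M
    ¬2y<M 2y<M = <-asym 3M<4y (begin-strict
      4 * y        ≡⟨ *-assoc 2 2 y ⟩
      2 * (2 * y)  <⟨ *-monoʳ-< 2 2y<M ⟩
      2 * M        ≤⟨ *-monoˡ-≤ M (n≤1+n 2) ⟩
      3 * M        ∎)
    odd : ¬ orbit (suc n) % 2 ≡ 0
    odd v-even = 0≢1+n (begin-equality
      0                                  ≡⟨ n∣m⇒m%n≡0 _ 2 (m∣m*n (orbit n)) ⟨
      2 * orbit n % 2                    ≡⟨ cong (_% 2) (orbit-suc-high n 3M<4u) ⟨
      (orbit (suc n) + M) % 2            ≡⟨ %-distribˡ-+ (orbit (suc n)) M 2 ⟩
      (orbit (suc n) % 2 + M % 2) % 2    ≡⟨ cong₂ (λ a b → (a + b) % 2) v-even M-odd ⟩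
      1                                  ∎)

-- The first m odd primes

increasing⇒injective : ∀ {m} {p : Fin m → ℕ} → (∀ i j → toℕ i < toℕ j → p i < p j) →
                       Injective _≡_ _≡_ p
increasing⇒injective increasing {i} {j} pi≡pj with <-cmp (toℕ i) (toℕ j)
... | tri< i<j _ _ = ⊥-elim (<⇒≢ (increasing i j i<j) pi≡pj)
... | tri≈ _ i≡j _ = Fin.toℕ-injective i≡j
... | tri> _ _ j<i = ⊥-elim (<⇒≢ (increasing j i j<i) (sym pi≡pj))

odd-prime%2≡1 : ∀ {q} → Prime q → q ≢ 2 → q % 2 ≡ 1
odd-prime%2≡1 {q} q-prime q≢2 with q % 2 in q%2≡ | m%n<n q 2
... | 0           | _ = ⊥-elim (q≢2 (sym (prime∣prime⇒≡ prime[2] q-prime (m%n≡0⇒n∣m q 2 q%2≡))))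
... | 1           | _ = refl
... | suc (suc _) | s≤s (s≤s ())

∃prime∣ : ∀ n → 1 < n → ∃ λ q → Prime q × q ∣ n
∃prime∣ (suc n) 1<n with factorise (suc n)
... | record { factors = [] ; isFactorisation = n≡1 } = ⊥-elim (<⇒≢ 1<n (sym n≡1))
... | record { factors = q ∷ qs ; isFactorisation = n≡ ; factorsPrime = q-prime ∷ _ } =
  q , q-prime , divides (product qs) (trans n≡ (*-comm q (product qs)))

below-top⇒inject₁ : ∀ {m} {p : Fin (suc m) → ℕ} j → p j < p (fromℕ m) → ∃ λ j′ → inject₁ j′ ≡ j
below-top⇒inject₁ j pj<top with view j
... | ‵fromℕ      = ⊥-elim (<-irrefl refl pj<top)
... | ‵inject₁ j′ = j′ , refl

top-largest : ∀ {m} {p : Fin (suc m) → ℕ} → (∀ i j → toℕ i < toℕ j → p i < p j) →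
              ∀ i → p (inject₁ i) < p (fromℕ m)
top-largest {m} increasing i =
  increasing (inject₁ i) (fromℕ m) (subst (toℕ (inject₁ i) <_) (sym (Fin.toℕ-fromℕ m)) (Fin.inject₁ℕ< i))

IsFirstOddPrimes-inject₁ : ∀ {m p} → IsFirstOddPrimes (suc m) p → IsFirstOddPrimes m (p ∘ inject₁)
IsFirstOddPrimes-inject₁ {m} {p} (odd-prime , increasing , closed) =
  odd-prime ∘ inject₁ , increasing′ , closed′
  where
  increasing′ : ∀ i j → toℕ i < toℕ j → p (inject₁ i) < p (inject₁ j)
  increasing′ i j i<j =
    increasing (inject₁ i) (inject₁ j) (subst₂ _<_ (sym (Fin.toℕ-inject₁ i)) (sym (Fin.toℕ-inject₁ j)) i<j)
  closed′ : ∀ q → Prime q → q ≢ 2 → ∀ i → q < p (inject₁ i) → ∃ λ j → p (inject₁ j) ≡ q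
  closed′ q q-prime q≢2 i q<pi with closed q q-prime q≢2 (inject₁ i) q<pi
  ... | j , pj≡q with below-top⇒inject₁ j (subst (_< _) (sym pj≡q) (<-trans q<pi (top-largest increasing i)))
  ...   | j′ , refl = j′ , pj≡q

-- Euclid: every prime factor of 2 p₁ ⋯ pₘ + 1 is odd and differs from p₁, …, pₘ.
top≤2*prodF+1 : ∀ {m p} → IsFirstOddPrimes (suc m) p → p (fromℕ m) ≤ 2 * prodF m (p ∘ inject₁) + 1
top≤2*prodF+1 {m} {p} (odd-prime , increasing , closed) =
  let q , q-prime , q∣Q = ∃prime∣ Q 1<Q
  in ≤-trans (top≤prime∣Q q-prime q∣Q) (∣⇒≤ {{>-nonZero (<-trans z<s 1<Q)}} q∣Q)
  where
  P = prodF m (p ∘ inject₁)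
  Q = 2 * P + 1
  instance
    P-nonZero : NonZero P
    P-nonZero = prodF-nonZero m (p ∘ inject₁) (λ i → prime⇒nonZero (proj₁ (odd-prime (inject₁ i))))
  1<Q : 1 < Q
  1<Q = +-monoˡ-< 1 (>-nonZero⁻¹ (2 * P) {{m*n≢0 2 P}})
  top≤prime∣Q : ∀ {q} → Prime q → q ∣ Q → p (fromℕ m) ≤ q
  top≤prime∣Q {q} q-prime q∣Q = ≮⇒≥ q≮top
    where
    ∤2P : ¬ q ∣ 2 * P
    ∤2P q∣2P = ¬prime[1] (subst Prime (∣1⇒≡1 (∣m+n∣m⇒∣n q∣Q q∣2P)) q-prime)
    q≢2 : q ≢ 2
    q≢2 refl = ∤2P (m∣m*n P)
    q≮top : ¬ q < p (fromℕ m)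
    q≮top q<top with closed q q-prime q≢2 (fromℕ m) q<top
    ... | j , pj≡q with below-top⇒inject₁ j (subst (_< _) (sym pj≡q) q<top)
    ...   | j′ , refl = ∤2P (∣n⇒∣m*n 2 (subst (_∣ P) pj≡q (∣prodF m (p ∘ inject₁) j′)))

3*prodF≤3^2^m : ∀ m {p} → IsFirstOddPrimes m p → 3 * prodF m p ≤ 3 ^ 2 ^ m
3*prodF≤3^2^m zero    _ = ≤-refl
3*prodF≤3^2^m (suc m) {p} firstOdd = begin
  3 * prodF (suc m) p      ≡⟨ cong (3 *_) (prodF-inject₁ m p) ⟩
  3 * (P * p (fromℕ m))    ≡⟨ *-assoc 3 P _ ⟨
  3 * P * p (fromℕ m)      ≤⟨ *-monoʳ-≤ (3 * P) top≤3P ⟩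
  3 * P * (3 * P)          ≤⟨ *-mono-≤ ih ih ⟩
  3 ^ 2 ^ m * 3 ^ 2 ^ m    ≡⟨ ^-distribˡ-+-* 3 (2 ^ m) (2 ^ m) ⟨
  3 ^ (2 ^ m + 2 ^ m)      ≡⟨ cong (λ e → 3 ^ (2 ^ m + e)) (+-identityʳ (2 ^ m)) ⟨
  3 ^ 2 ^ suc m            ∎
  where
  open ≤-Reasoning
  P = prodF m (p ∘ inject₁)
  ih : 3 * P ≤ 3 ^ 2 ^ m
  ih = 3*prodF≤3^2^m m (IsFirstOddPrimes-inject₁ firstOdd)
  P-nonZero : NonZero P
  P-nonZero = prodF-nonZero m (p ∘ inject₁) (λ i → prime⇒nonZero (proj₁ (proj₁ firstOdd (inject₁ i))))
  top≤3P : p (fromℕ m) ≤ 3 * P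
  top≤3P = begin
    p (fromℕ m)  ≤⟨ top≤2*prodF+1 firstOdd ⟩
    2 * P + 1    ≤⟨ +-monoʳ-≤ (2 * P) (>-nonZero⁻¹ P {{P-nonZero}}) ⟩
    2 * P + P    ≡⟨ +-comm (2 * P) P ⟩
    3 * P        ∎

bigM≤2^2^[1+m] : ∀ m {p} → IsFirstOddPrimes m p → bigM m p ≤ 2 ^ 2 ^ suc m
bigM≤2^2^[1+m] m {p} firstOdd = begin
  prodF m p          ≤⟨ m≤n*m (prodF m p) 3 ⟩
  3 * prodF m p      ≤⟨ 3*prodF≤3^2^m m firstOdd ⟩
  3 ^ 2 ^ m          ≤⟨ ^-monoˡ-≤ (2 ^ m) (n≤1+n 3) ⟩
  4 ^ 2 ^ m          ≡⟨ ^-*-assoc 2 2 (2 ^ m) ⟩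
  2 ^ 2 ^ suc m      ∎
  where open ≤-Reasoning

-- The least good exponent

module KStar {m : ℕ} {p : Fin m → ℕ} (firstOdd : IsFirstOddPrimes m p)
  {h : ℕ} (4m<2^h : 4 * m < 2 ^ h) {inv : Fin m → ℕ} (inverses : IsInverses m p inv) (x : ℤ) where

  p-prime : ∀ i → Prime (p i)
  p-prime i = proj₁ (proj₁ firstOdd i)

  open Reconstruction inv p-prime (increasing⇒injective (proj₁ (proj₂ firstOdd))) inverses
    using (M; M-nonZero; ¬FracSigmaSmall⇒FarFromHalf)

  M-odd : M % 2 ≡ 1
  M-odd = prodF-odd m p (λ i → odd-prime%2≡1 (p-prime i) (proj₂ (proj₁ firstOdd i)))

  y<M : [ x ]ℤ M < M
  y<M = subst (_< M) (sym ([]ℤ≡%ℕ x M)) (n%ℕd<d x M)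

  open Doubling M ([ x ]ℤ M) y<M

  orbit-spec : ∀ k → [ + (2 ^ k) *ℤ x ]ℤ M ≡ orbit k
  orbit-spec k = [a*x]ℤ≡a*[x]ℤ% (2 ^ k) x M

  FracSigmaSmall⇒Good : ∀ {k} → FracSigmaSmall m p inv h (orbit k) → Good m p inv h x k
  FracSigmaSmall⇒Good {k} = subst (FracSigmaSmall m p inv h) (sym (orbit-spec k))

  good? : ∀ k → Dec (Good m p inv h x k)
  good? k = _ ≤? _

  ¬Good⇒FarFromHalf : ∀ k → ¬ Good m p inv h x k → FarFromHalf M (orbit k)
  ¬Good⇒FarFromHalf k bad =
    ¬FracSigmaSmall⇒FarFromHalf h (orbit k) 4m<2^h (orbit<M k) (bad ∘ FracSigmaSmall⇒Good {k})

  K : ℕ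
  K = 2 ^ suc m

  -- Since M ≤ 2 ^ K, a run of K + 1 bad exponents forces [x]_M = 0, and then 0 is good.
  no-bad-run : ¬ (∀ j → j ≤ K → ¬ Good m p inv h x j)
  no-bad-run bad = bad 0 z≤n (FracSigmaSmall⇒Good {0}
    (subst (FracSigmaSmall m p inv h) (sym (trans orbit-0 y≡0)) (FracSigmaSmall-0 m p inv h)))
    where
    y≡0 : [ x ]ℤ M ≡ 0
    y≡0 = far-run⇒y≡0 K (bigM≤2^2^[1+m] m firstOdd) (λ j j≤K → ¬Good⇒FarFromHalf j (bad j j≤K))

  good-exists : ∃ λ k → Good m p inv h x k
  good-exists with Fin.any? {n = suc K} (good? ∘ toℕ)
  ... | yes (i , good) = toℕ i , good
  ... | no none = ⊥-elim (no-bad-run λ j j≤K good →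
          none (fromℕ< (s≤s j≤K) , subst (Good m p inv h x) (sym (Fin.toℕ-fromℕ< (s≤s j≤K))) good))

  kstar≤K : ∀ k → IsKStar m p inv h x k → k ≤ K
  kstar≤K k (_ , minimal) = ≮⇒≥ λ K<k → no-bad-run (λ j j≤K → minimal j (≤-<-trans j≤K K<k))

  kstar-parity : ∀ k → IsKStar m p inv h x k → 0 < k →
                 (2 * [ x ]ℤ M < M ⇔ ([ + (2 ^ k) *ℤ x ]ℤ M) %' 2 ≡ 0)
  kstar-parity (suc n) (_ , minimal) _ =
    subst (λ t → 2 * [ x ]ℤ M < M ⇔ t % 2 ≡ 0) (sym (orbit-spec (suc n)))
          (far-run⇒parity M-odd n (λ j j≤n → ¬Good⇒FarFromHalf j (minimal j (s≤s j≤n))))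

lemma5 : Σ (List ℕ) λ P →
    ∀ (m : ℕ) → 1 ≤ m →
    ∀ (p : Fin m → ℕ) → IsFirstOddPrimes m p →
    ∀ (h : ℕ) → 4 * m < 2 ^ h →
    ∀ (inv : Fin m → ℕ) → IsInverses m p inv →
    ∀ (x : ℤ) →
      (∃ λ k → Good m p inv h x k)
      × (∀ k → IsKStar m p inv h x k →
           k ≤ 2 ^ evalPoly P m
           × (0 < k →
              ((2 * [ x ]ℤ bigM m p < bigM m p)
                ⇔ (([ (+ (2 ^ k)) *ℤ x ]ℤ bigM m p) %' 2 ≡ 0))))
-- P = 1 + X, i.e. k* ≤ 2 ^ (m + 1).
lemma5 = 1 ∷ 1 ∷ [] , λ m _ p firstOdd h 4m<2^h inv inverses x →
  let open KStar firstOdd {h} 4m<2^h {inv} inverses x in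
  good-exists , λ k kstar →
    ≤-trans (kstar≤K k kstar) (≤-reflexive (cong (2 ^_) (exponent m))) , kstar-parity k kstar
  where
  exponent : ∀ m → suc m ≡ 1 + m * (1 + m * 0)
  exponent = ℕ-Ring.solve-∀
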